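{- Let $p\ge 2$ be an integer and let $P_n$ be the path on $n$ vertices. If $\gamma_p(P_n)>p$, then $r_p(P_n)=2$ if $p=2$ and $n$ is odd; $r_p(P_n)=1$ if $p=2$ and $n$ is even; and $r_p(P_n)=p-2$ if $p\ge 3$.
   Context: For a graph $G=(V,E)$, a set $D\subseteq V$ is a $p$-dominating set if every vertex $x\notin D$ has at least $p$ neighbours in $D$; $\gamma_p(G)$ is the minimum size of a $p$-dominating set. For $B\subseteq E(G^c)$ (edges of the complement), $G+B=(V,E\cup B)$. The $p$-reinforcement number is $r_p(G)=\min\{|B| : B\subseteq E(G^c),\ \gamma_p(G+B)<\gamma_p(G)\}$, with the convention $r_p(G)=0$ if $\gamma_p(G)\le p$. -}

module Defs where

open import Data.Nat using (ℕ; zero; suc; _+_; _≤_; _<_; _≡ᵇ_; _<ᵇ_)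
open import Data.Bool using (Bool; true; false; _∧_; _∨_; if_then_else_)
open import Data.Fin using (Fin; toℕ)
open import Data.Fin.Subset using (Subset; ∣_∣)
open import Data.Vec using (lookup)
open import Data.List using (List; map; allFin)
open import Data.Nat.ListAction using (sum)
open import Data.Product using (Σ; ∃; _×_; _,_)
open import Data.Sum using (_⊎_)
open import Relation.Binary.PropositionalEquality using (_≡_)

Graph : ℕ → Set
Graph n = Fin n → Fin n → Bool

path : (n : ℕ) → Graph n
path n i j = ((toℕ i + 1) ≡ᵇ toℕ j) ∨ ((toℕ j + 1) ≡ᵇ toℕ i)

nbrsIn : ∀ {n} → Graph n → Subset n → Fin n → ℕ
nbrsIn {n} G D x = sum (map (λ y → if G x y ∧ lookup D y then 1 else 0) (allFin n))

IsPDominating : ∀ {n} → ℕ → Graph n → Subset n → Set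
IsPDominating p G D = ∀ x → lookup D x ≡ false → p ≤ nbrsIn G D x

IsMin : (ℕ → Set) → ℕ → Set
IsMin P k = P k × (∀ m → P m → k ≤ m)

IsGammaP : ∀ {n} → ℕ → Graph n → ℕ → Set
IsGammaP p G = IsMin (λ k → Σ _ λ D → IsPDominating p G D × ∣ D ∣ ≡ k)

IsComplementEdgeSet : ∀ {n} → Graph n → Graph n → Set
IsComplementEdgeSet G B =
  (∀ x y → B x y ≡ B y x) × (∀ x → B x x ≡ false) × (∀ x y → B x y ≡ true → G x y ≡ false)

edgeCount : ∀ {n} → Graph n → ℕ
edgeCount {n} B =
  sum (map (λ i → sum (map (λ j → if B i j ∧ (toℕ i <ᵇ toℕ j) then 1 else 0) (allFin n))) (allFin n))

_⊕_ : ∀ {n} → Graph n → Graph n → Graph n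
(G ⊕ B) x y = G x y ∨ B x y

Reduces : ∀ {n} → ℕ → Graph n → Graph n → Set
Reduces p G B = ∀ g g' → IsGammaP p G g → IsGammaP p (G ⊕ B) g' → g' < g

-- r_p(G) = r  (with the convention r_p(G) = 0 when γ_p(G) ≤ p)
IsReinforcementP : ∀ {n} → ℕ → Graph n → ℕ → Set
IsReinforcementP p G r =
  (∃ λ g → IsGammaP p G g × g ≤ p × r ≡ 0)
  ⊎ (∃ λ g → IsGammaP p G g × p < g ×
       IsMin (λ k → Σ _ λ B → IsComplementEdgeSet G B × edgeCount B ≡ k × Reduces p G B) r)

-- The argument rests on two counts.  First, double counting (dominationDegreeBound):
-- if D is p-dominating in a symmetric graph H, every vertex outside D has p edges
-- into D and degree at least p, so 2p·|V ∖ D| ≤ Σ deg.  For P_n plus b extra edges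
-- the degree sum is at most 2(n - 1) + 2b, which for p = 2 gives n + 1 ≤ 2|D| + b.
-- Second, for p ≥ 3 a path has maximum degree 2, so γ_p(P_n) = n, and after adding
-- fewer than p - 2 edges all degrees still stay below p.
module Submission where

open import Defs
open import Data.Nat using (ℕ; zero; suc; _+_; _*_; _∸_; _⊓_; _≤_; _<_; _≡ᵇ_; _<ᵇ_; _%_; _/_; z≤n; s≤s; z<s; _≤?_; _<?_)
open import Data.Nat.Properties
open import Data.Nat.DivMod using (m≡m%n+[m/n]*n)
import Data.Nat.ListAction as ListAction
open import Data.Bool using (Bool; true; false; _∧_; _∨_; not; if_then_else_; T)
open import Data.Bool.Properties using (∧-identityʳ; ∧-zeroʳ; ∨-identityʳ; ∨-zeroʳ; ∨-comm)
open import Data.Fin using (Fin; zero; suc; toℕ; fromℕ<)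
open import Data.Fin.Properties using (toℕ-injective; toℕ-fromℕ<; toℕ<n) renaming (suc-injective to Fin-suc-injective)
open import Data.Fin.Subset using (Subset; ∣_∣; ⊤)
open import Data.Fin.Subset.Properties using (∣⊤∣≡n)
open import Data.Vec using (lookup; tabulate; []; _∷_)
open import Data.Vec.Properties using (lookup-replicate; lookup∘tabulate)
open import Data.List using (map; allFin)
import Data.List as List
open import Data.List.Properties using (map-tabulate)
open import Algebra.Properties.Semiring.Sum +-*-semiring
  using (∑-distrib-+; ∑-comm; sum-cong-≗; sum-replicate-zero; *-distribʳ-sum)
  renaming (sum to ∑)
open import Algebra.Properties.CommutativeSemigroup +-commutativeSemigroup using (x∙yz≈y∙xz)
open import Data.Nat.Tactic.RingSolver using (solve-∀)
open import Data.Empty using (⊥-elim)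
open import Data.Product using (Σ; _×_; _,_; proj₁; proj₂)
open import Data.Sum using (_⊎_; inj₁; inj₂)
open import Relation.Binary.Definitions using (tri<; tri≈; tri>)
open import Relation.Nullary using (¬_; yes; no)
open import Relation.Binary.PropositionalEquality
open import Function using (id)

-- Iverson bracket, written exactly as the indicator in the definitions of nbrsIn and edgeCount.
ind : Bool → ℕ
ind b = if b then 1 else 0

ind≤1 : ∀ b → ind b ≤ 1
ind≤1 true  = ≤-refl
ind≤1 false = z≤n

ind-∨ : ∀ a b → ind (a ∨ b) ≤ ind a + ind b
ind-∨ true  b = s≤s z≤n
ind-∨ false b = ≤-refl

ind-∧ : ∀ a b → ind (a ∧ b) ≤ ind a
ind-∧ true  b = ind≤1 b
ind-∧ false b = z≤n

ind-split : ∀ a b → ind a ≡ ind (a ∧ b) + ind (a ∧ not b)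
ind-split true  true  = refl
ind-split true  false = refl
ind-split false b     = refl

T⇒≡true : ∀ {b} → T b → b ≡ true
T⇒≡true {true} _ = refl

≡ᵇ-refl : ∀ a → (a ≡ᵇ a) ≡ true
≡ᵇ-refl a = T⇒≡true (≡⇒≡ᵇ a a refl)

≡ᵇ-≢ : ∀ a b → ¬ a ≡ b → (a ≡ᵇ b) ≡ false
≡ᵇ-≢ a b a≢b with a ≡ᵇ b in a≟b
... | false = refl
... | true  = ⊥-elim (a≢b (≡ᵇ⇒≡ a b (subst T (sym a≟b) _)))

≡ᵇ-true : ∀ a b → (a ≡ᵇ b) ≡ true → a ≡ b
≡ᵇ-true a b a≟b = ≡ᵇ⇒≡ a b (subst T (sym a≟b) _)

∨-cases : ∀ {a b} → (a ∨ b) ≡ true → a ≡ true ⊎ b ≡ true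
∨-cases {true}  _ = inj₁ refl
∨-cases {false} e = inj₂ e

∧-true : ∀ {a b} → (a ∧ b) ≡ true → a ≡ true × b ≡ true
∧-true {true} e = refl , e

≡ᵇ-sym : ∀ a b → (a ≡ᵇ b) ≡ (b ≡ᵇ a)
≡ᵇ-sym zero    zero    = refl
≡ᵇ-sym zero    (suc b) = refl
≡ᵇ-sym (suc a) zero    = refl
≡ᵇ-sym (suc a) (suc b) = ≡ᵇ-sym a b

<ᵇ-≥ : ∀ m n → n ≤ m → (m <ᵇ n) ≡ false
<ᵇ-≥ m n n≤m with m <ᵇ n in m<ᵇn
... | false = refl
... | true  = ⊥-elim (<⇒≱ (<ᵇ⇒< m n (subst T (sym m<ᵇn) _)) n≤m)

∨-introˡ : ∀ {x} y → x ≡ true → (x ∨ y) ≡ true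
∨-introˡ y refl = refl

∨-introʳ : ∀ x {y} → y ≡ true → (x ∨ y) ≡ true
∨-introʳ x refl = ∨-zeroʳ x

listSum≡∑ : ∀ {n} (f : Fin n → ℕ) → ListAction.sum (map f (allFin n)) ≡ ∑ f
listSum≡∑ {n} f = trans (cong ListAction.sum (map-tabulate id f)) (tabulated f)
  where
  tabulated : ∀ {m} (g : Fin m → ℕ) → ListAction.sum (List.tabulate g) ≡ ∑ g
  tabulated {zero}  g = refl
  tabulated {suc m} g = cong (g zero +_) (tabulated (λ i → g (suc i)))

∑-mono-≤ : ∀ {n} {f g : Fin n → ℕ} → (∀ i → f i ≤ g i) → ∑ f ≤ ∑ g
∑-mono-≤ {zero}  f≤g = z≤n
∑-mono-≤ {suc n} f≤g = +-mono-≤ (f≤g zero) (∑-mono-≤ (λ i → f≤g (suc i)))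

∑-ones : ∀ n → ∑ {n} (λ _ → 1) ≡ n
∑-ones zero    = refl
∑-ones (suc n) = cong suc (∑-ones n)

∑-term : ∀ {n} (f : Fin n → ℕ) a → f a ≤ ∑ f
∑-term f zero    = m≤m+n _ _
∑-term f (suc a) = ≤-trans (∑-term (λ i → f (suc i)) a) (m≤n+m _ (f zero))

∑-twoTerms : ∀ {n} (f : Fin n → ℕ) a b → ¬ a ≡ b → f a + f b ≤ ∑ f
∑-twoTerms f zero    zero    a≢b = ⊥-elim (a≢b refl)
∑-twoTerms f zero    (suc b) a≢b = +-monoʳ-≤ (f zero) (∑-term (λ i → f (suc i)) b)
∑-twoTerms f (suc a) zero    a≢b = begin
  f (suc a) + f zero  ≡⟨ +-comm (f (suc a)) (f zero) ⟩
  f zero + f (suc a)  ≤⟨ +-monoʳ-≤ (f zero) (∑-term (λ i → f (suc i)) a) ⟩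
  ∑ f                 ∎
  where open ≤-Reasoning
∑-twoTerms f (suc a) (suc b) a≢b =
  ≤-trans (∑-twoTerms (λ i → f (suc i)) a b (λ a≡b → a≢b (cong suc a≡b))) (m≤n+m _ (f zero))

∑-replaceTerm : ∀ {n} (f g : Fin n → ℕ) x → g x ≡ 0 → (∀ i → ¬ i ≡ x → g i ≤ f i) →
  f x + ∑ g ≤ ∑ f
∑-replaceTerm f g zero gx≡0 g≤f rewrite gx≡0 =
  +-monoʳ-≤ (f zero) (∑-mono-≤ (λ i → g≤f (suc i) λ ()))
∑-replaceTerm {suc n} f g (suc x) gx≡0 g≤f = begin
  f (suc x) + (g zero + ∑ g⁺)  ≡⟨ x∙yz≈y∙xz (f (suc x)) (g zero) (∑ g⁺) ⟩
  g zero + (f (suc x) + ∑ g⁺)  ≤⟨ +-mono-≤ (g≤f zero λ ()) rest ⟩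
  f zero + ∑ f⁺                ∎
  where
  open ≤-Reasoning
  f⁺ g⁺ : Fin n → ℕ
  f⁺ i = f (suc i)
  g⁺ i = g (suc i)
  rest : f⁺ x + ∑ g⁺ ≤ ∑ f⁺
  rest = ∑-replaceTerm f⁺ g⁺ x gx≡0 (λ i i≢x → g≤f (suc i) (λ e → i≢x (Fin-suc-injective e)))

deg : ∀ {n} → Graph n → Fin n → ℕ
deg H x = ∑ (λ y → ind (H x y))

degSum : ∀ {n} → Graph n → ℕ
degSum H = ∑ (deg H)

Symmetric : ∀ {n} → Graph n → Set
Symmetric H = ∀ x y → H x y ≡ H y x

outside : ∀ {n} → Subset n → ℕ
outside D = ∑ (λ x → ind (not (lookup D x)))

nbrsIn≡∑ : ∀ {n} (H : Graph n) D x → nbrsIn H D x ≡ ∑ (λ y → ind (H x y ∧ lookup D y))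
nbrsIn≡∑ H D x = listSum≡∑ (λ y → ind (H x y ∧ lookup D y))

nbrsIn≤deg : ∀ {n} (H : Graph n) D x → nbrsIn H D x ≤ deg H x
nbrsIn≤deg H D x rewrite nbrsIn≡∑ H D x = ∑-mono-≤ (λ y → ind-∧ (H x y) (lookup D y))

∣D∣≡∑ : ∀ {n} (D : Subset n) → ∣ D ∣ ≡ ∑ (λ x → ind (lookup D x))
∣D∣≡∑ []          = refl
∣D∣≡∑ (true ∷ D)  = cong suc (∣D∣≡∑ D)
∣D∣≡∑ (false ∷ D) = ∣D∣≡∑ D

n≡∣D∣+outside : ∀ {n} (D : Subset n) → n ≡ ∣ D ∣ + outside D
n≡∣D∣+outside {n} D = begin
  n                                                           ≡⟨ sym (∑-ones n) ⟩
  ∑ {n} (λ x → 1)                                             ≡⟨ sum-cong-≗ (λ x → inOrOut (lookup D x)) ⟩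
  ∑ {n} (λ x → ind (lookup D x) + ind (not (lookup D x)))     ≡⟨ ∑-distrib-+ (λ x → ind (lookup D x)) (λ x → ind (not (lookup D x))) ⟩
  ∑ (λ x → ind (lookup D x)) + outside D                      ≡⟨ cong (_+ outside D) (sym (∣D∣≡∑ D)) ⟩
  ∣ D ∣ + outside D                                           ∎
  where
  open ≡-Reasoning
  inOrOut : ∀ b → 1 ≡ ind b + ind (not b)
  inOrOut true  = refl
  inOrOut false = refl

-- Double counting for p-domination: each vertex outside D sends at least p edges
-- into D, and, having degree at least p, receives at least p edge-ends.
dominationDegreeBound : ∀ {n} p (H : Graph n) D → Symmetric H → IsPDominating p H D →
  outside D * p + outside D * p ≤ degSum H
dominationDegreeBound {n} p H D sym-H dom = begin
  outside D * p + outside D * p                   ≡⟨ cong₂ _+_ (*-distribʳ-sum p outsider) (*-distribʳ-sum p outsider) ⟩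
  ∑ quota + ∑ quota                               ≤⟨ +-mono-≤ (∑-mono-≤ quota≤intoD) (∑-mono-≤ quota≤fromOutside) ⟩
  ∑ intoD + ∑ (λ y → ∑ (λ x → intoOutside x y))   ≡⟨ cong (∑ intoD +_) (sym (∑-comm intoOutside)) ⟩
  ∑ intoD + ∑ (λ x → ∑ (intoOutside x))           ≡⟨ sym (∑-distrib-+ intoD _) ⟩
  ∑ (λ x → intoD x + ∑ (intoOutside x))           ≡⟨ sum-cong-≗ (λ x → sym (∑-distrib-+ _ (intoOutside x))) ⟩
  ∑ (λ x → ∑ (λ y → ind (H x y ∧ d y) + intoOutside x y))
                                                  ≡⟨ sum-cong-≗ (λ x → sum-cong-≗ (λ y → sym (ind-split (H x y) (d y)))) ⟩
  degSum H                                        ∎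
  where
  open ≤-Reasoning
  d = lookup D
  outsider : Fin n → ℕ
  outsider x = ind (not (d x))
  quota : Fin n → ℕ
  quota x = outsider x * p
  intoD : Fin n → ℕ
  intoD x = ∑ (λ y → ind (H x y ∧ d y))
  intoOutside : Fin n → Fin n → ℕ
  intoOutside x y = ind (H x y ∧ not (d y))
  dominated : ∀ x → d x ≡ false → p ≤ intoD x
  dominated x x∉D = subst (p ≤_) (nbrsIn≡∑ H D x) (dom x x∉D)
  quota≤intoD : ∀ x → quota x ≤ intoD x
  quota≤intoD x with d x in x∈?D
  ... | true  = z≤n
  ... | false = subst (_≤ intoD x) (sym (+-identityʳ p)) (dominated x x∈?D)
  quota≤fromOutside : ∀ y → quota y ≤ ∑ (λ x → intoOutside x y)
  quota≤fromOutside y with d y in y∈?D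
  ... | true  = z≤n
  ... | false = begin
    p + 0                               ≡⟨ +-identityʳ p ⟩
    p                                   ≤⟨ dominated y y∈?D ⟩
    intoD y                             ≤⟨ ∑-mono-≤ (λ x → ind-∧ (H y x) (d x)) ⟩
    deg H y                             ≡⟨ sum-cong-≗ (λ x → cong ind (trans (sym-H y x) (sym (∧-identityʳ (H x y))))) ⟩
    ∑ (λ x → ind (H x y ∧ true))        ∎

Loopless : ∀ {n} → Graph n → Set
Loopless B = ∀ x → B x x ≡ false

upperRow upperColumn : ∀ {n} → Graph n → Fin n → ℕ
upperRow    B x = ∑ (λ j → ind (B x j ∧ (toℕ x <ᵇ toℕ j)))
upperColumn B x = ∑ (λ i → ind (B i x ∧ (toℕ i <ᵇ toℕ x)))

edgeCount≡∑ : ∀ {n} (B : Graph n) → edgeCount B ≡ ∑ (upperRow B)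
edgeCount≡∑ {n} B =
  trans (listSum≡∑ (λ i → ListAction.sum (map (λ j → ind (B i j ∧ (toℕ i <ᵇ toℕ j))) (allFin n))))
        (sum-cong-≗ (λ i → listSum≡∑ (λ j → ind (B i j ∧ (toℕ i <ᵇ toℕ j)))))

∑upperColumn≡edgeCount : ∀ {n} (B : Graph n) → ∑ (upperColumn B) ≡ edgeCount B
∑upperColumn≡edgeCount B =
  trans (∑-comm (λ x i → ind (B i x ∧ (toℕ i <ᵇ toℕ x)))) (sym (edgeCount≡∑ B))

deg≤row+column : ∀ {n} (B : Graph n) → Symmetric B → Loopless B → ∀ x →
  deg B x ≤ upperRow B x + upperColumn B x
deg≤row+column B sym-B loopless x =
  ≤-trans (∑-mono-≤ edgeAt) (≤-reflexive (∑-distrib-+ (λ y → ind (B x y ∧ (toℕ x <ᵇ toℕ y))) _))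
  where
  edgeAt : ∀ y → ind (B x y) ≤ ind (B x y ∧ (toℕ x <ᵇ toℕ y)) + ind (B y x ∧ (toℕ y <ᵇ toℕ x))
  edgeAt y rewrite sym-B y x with <-cmp (toℕ x) (toℕ y)
  ... | tri< x<y _ _ rewrite T⇒≡true (<⇒<ᵇ x<y) | ∧-identityʳ (B x y) = m≤m+n _ _
  ... | tri> _ _ y<x rewrite T⇒≡true (<⇒<ᵇ y<x) | ∧-identityʳ (B x y) = m≤n+m _ _
  ... | tri≈ _ x≡y _ with toℕ-injective x≡y
  ...   | refl rewrite loopless x = z≤n

deg≤edgeCount : ∀ {n} (B : Graph n) → Symmetric B → Loopless B → ∀ x → deg B x ≤ edgeCount B
deg≤edgeCount B sym-B loopless x = begin
  deg B x                           ≤⟨ deg≤row+column B sym-B loopless x ⟩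
  upperRow B x + upperColumn B x    ≤⟨ ∑-replaceTerm (upperRow B) (λ i → ind (B i x ∧ (toℕ i <ᵇ toℕ x)))
                                         x (cong (λ b → ind (b ∧ _)) (loopless x))
                                         (λ i _ → ∑-term (λ j → ind (B i j ∧ (toℕ i <ᵇ toℕ j))) x) ⟩
  ∑ (upperRow B)                    ≡⟨ sym (edgeCount≡∑ B) ⟩
  edgeCount B                       ∎
  where open ≤-Reasoning

degSum≤2edgeCount : ∀ {n} (B : Graph n) → Symmetric B → Loopless B →
  degSum B ≤ edgeCount B + edgeCount B
degSum≤2edgeCount B sym-B loopless = begin
  degSum B                                     ≤⟨ ∑-mono-≤ (deg≤row+column B sym-B loopless) ⟩
  ∑ (λ x → upperRow B x + upperColumn B x)     ≡⟨ ∑-distrib-+ (upperRow B) (upperColumn B) ⟩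
  ∑ (upperRow B) + ∑ (upperColumn B)           ≡⟨ cong₂ _+_ (sym (edgeCount≡∑ B)) (∑upperColumn≡edgeCount B) ⟩
  edgeCount B + edgeCount B                    ∎
  where open ≤-Reasoning

noEdges : ∀ {n} (B : Graph n) → Symmetric B → Loopless B → edgeCount B ≡ 0 → ∀ x y → B x y ≡ false
noEdges B sym-B loopless count≡0 x y with B x y in xy∈B
... | false = refl
... | true  = ⊥-elim (1+n≰n (begin
  1             ≡⟨ cong ind (sym xy∈B) ⟩
  ind (B x y)   ≤⟨ ∑-term (λ z → ind (B x z)) y ⟩
  deg B x       ≤⟨ deg≤edgeCount B sym-B loopless x ⟩
  edgeCount B   ≡⟨ count≡0 ⟩
  0             ∎))
  where open ≤-Reasoning

deg-⊕ : ∀ {n} (G B : Graph n) x → deg (G ⊕ B) x ≤ deg G x + deg B x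
deg-⊕ G B x = ≤-trans (∑-mono-≤ (λ y → ind-∨ (G x y) (B x y)))
                      (≤-reflexive (∑-distrib-+ (λ y → ind (G x y)) (λ y → ind (B x y))))

degSum-⊕ : ∀ {n} (G B : Graph n) → degSum (G ⊕ B) ≤ degSum G + degSum B
degSum-⊕ G B = ≤-trans (∑-mono-≤ (deg-⊕ G B)) (≤-reflexive (∑-distrib-+ (deg G) (deg B)))

dominating-⊕ : ∀ {n} p (G B : Graph n) D → IsPDominating p G D → IsPDominating p (G ⊕ B) D
dominating-⊕ p G B D dom x x∉D = begin
  p                   ≤⟨ dom x x∉D ⟩
  nbrsIn G D x        ≡⟨ nbrsIn≡∑ G D x ⟩
  ∑ (λ y → ind (G x y ∧ lookup D y))           ≤⟨ ∑-mono-≤ (λ y → more (G x y) (B x y) (lookup D y)) ⟩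
  ∑ (λ y → ind ((G x y ∨ B x y) ∧ lookup D y)) ≡⟨ sym (nbrsIn≡∑ (G ⊕ B) D x) ⟩
  nbrsIn (G ⊕ B) D x  ∎
  where
  open ≤-Reasoning
  more : ∀ a b c → ind (a ∧ c) ≤ ind ((a ∨ b) ∧ c)
  more true  b c = ≤-refl
  more false b c = z≤n

-- The whole vertex set is p-dominating, so γ_p(G) ≤ n.
γ≤n : ∀ {n} p (G : Graph n) g → IsGammaP p G g → g ≤ n
γ≤n {n} p G g (_ , minimal) = minimal n (⊤ , everyVertexIn , ∣⊤∣≡n n)
  where
  everyVertexIn : IsPDominating p G ⊤
  everyVertexIn x x∉⊤ with trans (sym (lookup-replicate x true)) x∉⊤
  ... | ()

lowDegreeFull : ∀ {n} p (H : Graph n) D → (∀ x → deg H x < p) → IsPDominating p H D → ∣ D ∣ ≡ n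
lowDegreeFull {n} p H D lowDeg dom = trans (∣D∣≡∑ D) (trans (sum-cong-≗ inD) (∑-ones n))
  where
  inD : ∀ x → ind (lookup D x) ≡ 1
  inD x with lookup D x in x∈?D
  ... | true  = refl
  ... | false = ⊥-elim (<⇒≱ (≤-<-trans (nbrsIn≤deg H D x) (lowDeg x)) (dom x x∈?D))

reducesBelow : ∀ {n} p (G B : Graph n) L → (∀ D → IsPDominating p G D → L ≤ ∣ D ∣) →
  (D′ : Subset n) → IsPDominating p (G ⊕ B) D′ → ∣ D′ ∣ < L → Reduces p G B
reducesBelow p G B L bound D′ dom′ small g g′ ((D , dom , ∣D∣≡g) , _) (_ , minimal′) =
  ≤-<-trans (minimal′ ∣ D′ ∣ (D′ , dom′ , refl)) (<-≤-trans small (subst (L ≤_) ∣D∣≡g (bound D dom)))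

notReducing : ∀ {n} p (G B : Graph n) g → IsGammaP p G g →
  (∀ D → IsPDominating p (G ⊕ B) D → g ≤ ∣ D ∣) → ¬ Reduces p G B
notReducing p G B g γ≡g@((D , dom , ∣D∣≡g) , _) bound reduces =
  <-irrefl refl (reduces g g γ≡g ((D , dominating-⊕ p G B D dom , ∣D∣≡g) , minimal))
  where
  minimal : ∀ m → (Σ _ λ D′ → IsPDominating p (G ⊕ B) D′ × ∣ D′ ∣ ≡ m) → g ≤ m
  minimal m (D′ , dom′ , ∣D′∣≡m) = subst (g ≤_) ∣D′∣≡m (bound D′ dom′)

emptyNotReducing : ∀ {n} p (G B : Graph n) g → IsGammaP p G g → Symmetric B → Loopless B →
  edgeCount B ≡ 0 → ¬ Reduces p G B
emptyNotReducing p G B g γ≡g sym-B loopless count≡0 = notReducing p G B g γ≡g bound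
  where
  sameNbrs : ∀ D x → nbrsIn (G ⊕ B) D x ≡ nbrsIn G D x
  sameNbrs D x = begin
    nbrsIn (G ⊕ B) D x                            ≡⟨ nbrsIn≡∑ (G ⊕ B) D x ⟩
    ∑ (λ y → ind ((G x y ∨ B x y) ∧ lookup D y))  ≡⟨ sum-cong-≗ (λ y → cong (λ b → ind ((G x y ∨ b) ∧ lookup D y))
                                                                       (noEdges B sym-B loopless count≡0 x y)) ⟩
    ∑ (λ y → ind ((G x y ∨ false) ∧ lookup D y))  ≡⟨ sum-cong-≗ (λ y → cong (λ b → ind (b ∧ lookup D y)) (∨-identityʳ (G x y))) ⟩
    ∑ (λ y → ind (G x y ∧ lookup D y))            ≡⟨ sym (nbrsIn≡∑ G D x) ⟩
    nbrsIn G D x                                  ∎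
    where open ≡-Reasoning
  bound : ∀ D → IsPDominating p (G ⊕ B) D → g ≤ ∣ D ∣
  bound D dom = proj₂ γ≡g ∣ D ∣ (D , (λ x x∉D → subst (p ≤_) (sameNbrs D x) (dom x x∉D)) , refl)

reinforcementNumber : ∀ {n} p (G : Graph n) g r → IsGammaP p G g → p < g →
  (Σ _ λ B → IsComplementEdgeSet G B × edgeCount B ≡ r × Reduces p G B) →
  (∀ B → IsComplementEdgeSet G B → edgeCount B < r → ¬ Reduces p G B) →
  IsReinforcementP p G r
reinforcementNumber p G g r γ≡g p<g witness fewerFail = inj₂ (g , γ≡g , p<g , witness , minimal)
  where
  minimal : ∀ k → (Σ _ λ B → IsComplementEdgeSet G B × edgeCount B ≡ k × Reduces p G B) → r ≤ k
  minimal k (B , complement , count≡k , reduces) with r ≤? k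
  ... | yes r≤k = r≤k
  ... | no  r≰k = ⊥-elim (fewerFail B complement (subst (_< _) (sym count≡k) (≰⇒> r≰k)) reduces)

countEqual : ∀ n c → ∑ {n} (λ y → ind (c ≡ᵇ toℕ y)) ≡ ind (c <ᵇ n)
countEqual zero    c       = refl
countEqual (suc n) zero    = cong suc (sum-replicate-zero n)
countEqual (suc n) (suc c) = countEqual n c

countBelow : ∀ n m → ∑ {n} (λ x → ind (toℕ x <ᵇ m)) ≡ n ⊓ m
countBelow zero    m       = refl
countBelow (suc n) zero    = sum-replicate-zero n
countBelow (suc n) (suc m) = cong suc (countBelow n m)

countPredecessor : ∀ n c → ∑ {n} (λ y → ind (suc (toℕ y) ≡ᵇ c)) ≤ 1
countPredecessor n zero    = ≤-trans (≤-reflexive (sum-replicate-zero n)) z≤n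
countPredecessor n (suc c) = begin
  ∑ {n} (λ y → ind (toℕ y ≡ᵇ c))  ≡⟨ sum-cong-≗ {n} (λ y → cong ind (≡ᵇ-sym (toℕ y) c)) ⟩
  ∑ {n} (λ y → ind (c ≡ᵇ toℕ y))  ≡⟨ countEqual n c ⟩
  ind (c <ᵇ n)                     ≤⟨ ind≤1 (c <ᵇ n) ⟩
  1                                ∎
  where open ≤-Reasoning

-- Adjacency of the path on ℕ; path n is this relation restricted to Fin n.
pathRel : ℕ → ℕ → Bool
pathRel i j = ((i + 1) ≡ᵇ j) ∨ ((j + 1) ≡ᵇ i)

pathRel-sym : ∀ i j → pathRel i j ≡ pathRel j i
pathRel-sym i j = ∨-comm ((i + 1) ≡ᵇ j) ((j + 1) ≡ᵇ i)

path-symmetric : ∀ {n} → Symmetric (path n)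
path-symmetric x y = pathRel-sym (toℕ x) (toℕ y)

pathRel-suc : ∀ i j → pathRel i j ≡ (suc i ≡ᵇ j) ∨ (suc j ≡ᵇ i)
pathRel-suc i j rewrite +-comm i 1 | +-comm j 1 = refl

rightNbr : ∀ {n} → Fin n → Fin n → ℕ
rightNbr x y = ind (suc (toℕ x) ≡ᵇ toℕ y)

pathEdge≤ : ∀ {n} (x y : Fin n) → ind (path n x y) ≤ rightNbr x y + rightNbr y x
pathEdge≤ x y rewrite pathRel-suc (toℕ x) (toℕ y) =
  ind-∨ (suc (toℕ x) ≡ᵇ toℕ y) (suc (toℕ y) ≡ᵇ toℕ x)

deg-path≤2 : ∀ {n} x → deg (path n) x ≤ 2
deg-path≤2 {n} x = begin
  deg (path n) x                          ≤⟨ ∑-mono-≤ (pathEdge≤ x) ⟩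
  ∑ (λ y → rightNbr x y + rightNbr y x)   ≡⟨ ∑-distrib-+ (rightNbr x) (λ y → rightNbr y x) ⟩
  ∑ (rightNbr x) + ∑ (λ y → rightNbr y x) ≤⟨ +-mono-≤ right (countPredecessor n (toℕ x)) ⟩
  2                                       ∎
  where
  open ≤-Reasoning
  right : ∑ (rightNbr x) ≤ 1
  right = ≤-trans (≤-reflexive (countEqual n (suc (toℕ x)))) (ind≤1 _)

double : ∀ a → a * 2 ≡ a + a
double = solve-∀

-- P_n has n-1 edges, so its degree sum is at most 2(n-1).
degSum-path : ∀ m → degSum (path (suc m)) ≤ m * 2
degSum-path m = begin
  degSum (path n)                                   ≤⟨ ∑-mono-≤ {n} (λ x → ∑-mono-≤ {n} (pathEdge≤ x)) ⟩
  ∑ (λ x → ∑ (λ y → rightNbr {n} x y + rightNbr y x)) ≡⟨ sum-cong-≗ {n} (λ x → ∑-distrib-+ {n} (rightNbr x) (λ y → rightNbr y x)) ⟩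
  ∑ (λ x → rightNbrs x + leftNbrs x)                ≡⟨ ∑-distrib-+ {n} rightNbrs leftNbrs ⟩
  ∑ rightNbrs + ∑ leftNbrs                          ≡⟨ cong (∑ rightNbrs +_) (∑-comm {n} {n} (λ x y → rightNbr y x)) ⟩
  ∑ rightNbrs + ∑ rightNbrs                         ≡⟨ cong₂ _+_ rightEdges≡m rightEdges≡m ⟩
  m + m                                             ≡⟨ sym (double m) ⟩
  m * 2                                             ∎
  where
  open ≤-Reasoning
  n = suc m
  rightNbrs leftNbrs : Fin n → ℕ
  rightNbrs x = ∑ (rightNbr x)
  leftNbrs  x = ∑ (λ y → rightNbr y x)
  rightEdges≡m : ∑ rightNbrs ≡ m
  rightEdges≡m = begin-equality
    ∑ rightNbrs                       ≡⟨ sum-cong-≗ {n} (λ x → countEqual n (suc (toℕ x))) ⟩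
    ∑ {n} (λ x → ind (toℕ x <ᵇ m))    ≡⟨ countBelow n m ⟩
    n ⊓ m                             ≡⟨ m≥n⇒m⊓n≡n (n≤1+n m) ⟩
    m                                 ∎

twoDominationBound : ∀ m b (H : Graph (suc m)) D → Symmetric H → degSum H ≤ (m + b) * 2 →
  IsPDominating 2 H D → suc (suc m) ≤ ∣ D ∣ * 2 + b
twoDominationBound m b H D sym-H degSum≤ dom = +-cancelʳ-≤ m (suc (suc m)) (c * 2 + b) (begin
  suc (suc m) + m     ≡⟨ cong suc (sym (+-suc m m)) ⟩
  suc m + suc m       ≡⟨ cong₂ _+_ n≡c+o n≡c+o ⟩
  (c + o) + (c + o)   ≡⟨ regroup c o ⟩
  c * 2 + o * 2       ≤⟨ +-monoʳ-≤ (c * 2) o*2≤m+b ⟩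
  c * 2 + (m + b)     ≡⟨ rearrange c m b ⟩
  c * 2 + b + m       ∎)
  where
  open ≤-Reasoning
  c = ∣ D ∣
  o = outside D
  n≡c+o : suc m ≡ c + o
  n≡c+o = n≡∣D∣+outside D
  regroup : ∀ c o → (c + o) + (c + o) ≡ c * 2 + o * 2
  regroup = solve-∀
  rearrange : ∀ c m b → c * 2 + (m + b) ≡ c * 2 + b + m
  rearrange = solve-∀
  o*2≤m+b : o * 2 ≤ m + b
  o*2≤m+b = *-cancelʳ-≤ (o * 2) (m + b) 2 (begin
    o * 2 * 2       ≡⟨ double (o * 2) ⟩
    o * 2 + o * 2   ≤⟨ dominationDegreeBound 2 H D sym-H dom ⟩
    degSum H        ≤⟨ degSum≤ ⟩
    (m + b) * 2     ∎)

induced : ∀ {n} → (ℕ → ℕ → Bool) → Graph n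
induced R i j = R (toℕ i) (toℕ j)

subsetOf : ∀ {n} → (ℕ → Bool) → Subset n
subsetOf δ = tabulate (λ i → δ (toℕ i))

lookup-subsetOf : ∀ {n} δ (i : Fin n) → lookup (subsetOf δ) i ≡ δ (toℕ i)
lookup-subsetOf δ = lookup∘tabulate (λ i → δ (toℕ i))

∣subsetOf∣ : ∀ {n} δ → ∣ subsetOf {n} δ ∣ ≡ ∑ {n} (λ i → ind (δ (toℕ i)))
∣subsetOf∣ {n} δ = trans (∣D∣≡∑ (subsetOf {n} δ)) (sum-cong-≗ {n} (λ i → cong ind (lookup-subsetOf δ i)))

record TwoNeighbours (R : ℕ → ℕ → Bool) (δ : ℕ → Bool) (n x : ℕ) : Set where
  constructor twoNeighbours
  field
    a b     : ℕ
    a<n     : a < n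
    b<n     : b < n
    a≢b     : ¬ a ≡ b
    x~a     : R x a ≡ true
    x~b     : R x b ≡ true
    a∈δ     : δ a ≡ true
    b∈δ     : δ b ≡ true

twoDominating : ∀ n R δ → (∀ x → x < n → δ x ≡ false → TwoNeighbours R δ n x) →
  IsPDominating 2 (induced R) (subsetOf {n} δ)
twoDominating n R δ nbrs x x∉D with nbrs (toℕ x) (toℕ<n x) (trans (sym (lookup-subsetOf δ x)) x∉D)
... | twoNeighbours a b a<n b<n a≢b x~a x~b a∈δ b∈δ = begin
  2                                 ≡⟨ cong₂ _+_ (counted a<n x~a a∈δ) (counted b<n x~b b∈δ) ⟨
  term (fromℕ< a<n) + term (fromℕ< b<n)
                                    ≤⟨ ∑-twoTerms term (fromℕ< a<n) (fromℕ< b<n) distinct ⟩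
  ∑ term                            ≡⟨ nbrsIn≡∑ (induced R) (subsetOf δ) x ⟨
  nbrsIn (induced R) (subsetOf δ) x ∎
  where
  open ≤-Reasoning
  term : Fin n → ℕ
  term y = ind (R (toℕ x) (toℕ y) ∧ lookup (subsetOf δ) y)
  counted : ∀ {c} (c<n : c < n) → R (toℕ x) c ≡ true → δ c ≡ true → term (fromℕ< c<n) ≡ 1
  counted c<n x~c c∈δ rewrite lookup-subsetOf δ (fromℕ< c<n) | toℕ-fromℕ< c<n | x~c | c∈δ = refl
  distinct : ¬ fromℕ< a<n ≡ fromℕ< b<n
  distinct a≡b = a≢b (trans (sym (toℕ-fromℕ< a<n)) (trans (cong toℕ a≡b) (toℕ-fromℕ< b<n)))

pathRel-left : ∀ t → pathRel (suc t) t ≡ true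
pathRel-left t rewrite pathRel-suc (suc t) t | ≡ᵇ-refl t = ∨-zeroʳ _

pathRel-right : ∀ t → pathRel t (suc t) ≡ true
pathRel-right t rewrite pathRel-suc t (suc t) | ≡ᵇ-refl t = refl

interiorNeighbours : ∀ R δ n t → (∀ i j → pathRel i j ≡ true → R i j ≡ true) →
  suc (suc t) < n → δ t ≡ true → δ (suc (suc t)) ≡ true → TwoNeighbours R δ n (suc t)
interiorNeighbours R δ n t path⊆R t+2<n t∈δ t+2∈δ =
  twoNeighbours t (suc (suc t)) (<-trans (n<1+n t) (<-trans (n<1+n (suc t)) t+2<n)) t+2<n
    (λ t≡t+2 → <-irrefl t≡t+2 (<-trans (n<1+n t) (n<1+n (suc t))))
    (path⊆R _ _ (pathRel-left t)) (path⊆R _ _ (pathRel-right (suc t))) t∈δ t+2∈δ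

edge : ℕ → ℕ → ℕ → ℕ → Bool
edge a b i j = ((a ≡ᵇ i) ∧ (b ≡ᵇ j)) ∨ ((a ≡ᵇ j) ∧ (b ≡ᵇ i))

edge-endpoints : ∀ a b i j → edge a b i j ≡ true → (a ≡ i × b ≡ j) ⊎ (a ≡ j × b ≡ i)
edge-endpoints a b i j e with ∨-cases {(a ≡ᵇ i) ∧ (b ≡ᵇ j)} e
... | inj₁ e₁ = inj₁ (≡ᵇ-true a i (proj₁ (∧-true e₁)) , ≡ᵇ-true b j (proj₂ (∧-true {a ≡ᵇ i} e₁)))
... | inj₂ e₂ = inj₂ (≡ᵇ-true a j (proj₁ (∧-true e₂)) , ≡ᵇ-true b i (proj₂ (∧-true {a ≡ᵇ j} e₂)))

edge-symmetric : ∀ a b i j → edge a b i j ≡ edge a b j i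
edge-symmetric a b i j = ∨-comm ((a ≡ᵇ i) ∧ (b ≡ᵇ j)) ((a ≡ᵇ j) ∧ (b ≡ᵇ i))

edge-loopless : ∀ a b → ¬ a ≡ b → ∀ i → edge a b i i ≡ false
edge-loopless a b a≢b i with edge a b i i in e
... | false = refl
... | true with edge-endpoints a b i i e
...   | inj₁ (refl , refl) = ⊥-elim (a≢b refl)
...   | inj₂ (refl , refl) = ⊥-elim (a≢b refl)

edge-ab : ∀ a b → edge a b a b ≡ true
edge-ab a b rewrite ≡ᵇ-refl a | ≡ᵇ-refl b = refl

edge-ba : ∀ a b → edge a b b a ≡ true
edge-ba a b = trans (edge-symmetric a b b a) (edge-ab a b)

pathRel-far : ∀ a b → suc a < b → pathRel a b ≡ false
pathRel-far a b a+1<b rewrite pathRel-suc a b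
  | ≡ᵇ-≢ (suc a) b (<⇒≢ a+1<b)
  | ≡ᵇ-≢ (suc b) a (λ b+1≡a → <-asym (<-trans (n<1+n a) a+1<b) (≤-reflexive b+1≡a)) = refl

edge-notPath : ∀ a b → suc a < b → ∀ i j → edge a b i j ≡ true → pathRel i j ≡ false
edge-notPath a b a+1<b i j e with edge-endpoints a b i j e
... | inj₁ (refl , refl) = pathRel-far a b a+1<b
... | inj₂ (refl , refl) = trans (pathRel-sym b a) (pathRel-far a b a+1<b)

edge-upper : ∀ a b → a < b → ∀ i j → (edge a b i j ∧ (i <ᵇ j)) ≡ ((a ≡ᵇ i) ∧ (b ≡ᵇ j))
edge-upper a b a<b i j with edge a b i j in e
... | false = sym (firstFalse e)
  where
  firstFalse : ∀ {x y} → (x ∨ y) ≡ false → x ≡ false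
  firstFalse {false} _ = refl
... | true with edge-endpoints a b i j e
...   | inj₁ (refl , refl) rewrite ≡ᵇ-refl a | ≡ᵇ-refl b = T⇒≡true (<⇒<ᵇ a<b)
...   | inj₂ (refl , refl) = trans (<ᵇ-≥ b a (<⇒≤ a<b)) (cong (_∧ (b ≡ᵇ a)) (sym (≡ᵇ-≢ a b (<⇒≢ a<b))))

edgeCount-edge : ∀ n a b → a < b → b < n → edgeCount (induced {n} (edge a b)) ≡ 1
edgeCount-edge n a b a<b b<n = begin
  edgeCount (induced {n} (edge a b))                              ≡⟨ edgeCount≡∑ (induced {n} (edge a b)) ⟩
  ∑ {n} (λ i → ∑ {n} (λ j → ind (edge a b (toℕ i) (toℕ j) ∧ (toℕ i <ᵇ toℕ j))))
                                                                  ≡⟨ sum-cong-≗ {n} (λ i → sum-cong-≗ {n} (λ j →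
                                                                       cong ind (edge-upper a b a<b (toℕ i) (toℕ j)))) ⟩
  ∑ {n} (λ i → ∑ {n} (λ j → ind ((a ≡ᵇ toℕ i) ∧ (b ≡ᵇ toℕ j))))  ≡⟨ sum-cong-≗ {n} row ⟩
  ∑ {n} (λ i → ind (a ≡ᵇ toℕ i))                                 ≡⟨ countEqual n a ⟩
  ind (a <ᵇ n)                                                    ≡⟨ cong ind (T⇒≡true (<⇒<ᵇ (<-trans a<b b<n))) ⟩
  1                                                               ∎
  where
  open ≡-Reasoning
  row : ∀ i → ∑ {n} (λ j → ind ((a ≡ᵇ toℕ i) ∧ (b ≡ᵇ toℕ j))) ≡ ind (a ≡ᵇ toℕ i)
  row i with a ≡ᵇ toℕ i
  ... | true  = trans (countEqual n b) (cong ind (T⇒≡true (<⇒<ᵇ b<n)))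
  ... | false = sum-replicate-zero n

edgeCount-∪ : ∀ {n} (B C : Graph n) → (∀ x y → B x y ≡ true → C x y ≡ false) →
  edgeCount (λ x y → B x y ∨ C x y) ≡ edgeCount B + edgeCount C
edgeCount-∪ {n} B C disjoint = begin
  edgeCount (λ x y → B x y ∨ C x y)             ≡⟨ edgeCount≡∑ (λ x y → B x y ∨ C x y) ⟩
  ∑ (λ x → ∑ (λ y → ind ((B x y ∨ C x y) ∧ (toℕ x <ᵇ toℕ y))))
                                                ≡⟨ sum-cong-≗ {n} (λ x → trans (sum-cong-≗ {n} (λ y →
                                                     split (B x y) (C x y) _ (disjoint x y)))
                                                     (∑-distrib-+ (upperB x) (upperC x))) ⟩
  ∑ (λ x → ∑ (upperB x) + ∑ (upperC x))         ≡⟨ ∑-distrib-+ (upperRow B) (upperRow C) ⟩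
  ∑ (upperRow B) + ∑ (upperRow C)               ≡⟨ cong₂ _+_ (edgeCount≡∑ B) (edgeCount≡∑ C) ⟨
  edgeCount B + edgeCount C                     ∎
  where
  open ≡-Reasoning
  upperB upperC : Fin n → Fin n → ℕ
  upperB x y = ind (B x y ∧ (toℕ x <ᵇ toℕ y))
  upperC x y = ind (C x y ∧ (toℕ x <ᵇ toℕ y))
  split : ∀ b c l → (b ≡ true → c ≡ false) → ind ((b ∨ c) ∧ l) ≡ ind (b ∧ l) + ind (c ∧ l)
  split true  c true  b⇒¬c rewrite b⇒¬c refl = refl
  split true  c false b⇒¬c rewrite ∧-zeroʳ c = refl
  split false c l     b⇒¬c = refl

pathComplement : ∀ {n} β → (∀ i j → β i j ≡ β j i) → (∀ i → β i i ≡ false) →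
  (∀ i j → β i j ≡ true → pathRel i j ≡ false) → IsComplementEdgeSet (path n) (induced β)
pathComplement β sym-β loopless-β avoids =
  (λ x y → sym-β (toℕ x) (toℕ y)) , (λ x → loopless-β (toℕ x)) , (λ x y → avoids (toℕ x) (toℕ y))

edgeComplement : ∀ {n} a b → suc a < b → IsComplementEdgeSet (path n) (induced (edge a b))
edgeComplement a b a+1<b = pathComplement (edge a b) (edge-symmetric a b)
  (edge-loopless a b (λ a≡b → <-irrefl a≡b (<-trans (n<1+n a) a+1<b))) (edge-notPath a b a+1<b)

even odd : ℕ → Bool
even zero    = true
even (suc n) = odd n
odd  zero    = false
odd  (suc n) = even n

odd-if-not-even : ∀ t → even t ≡ false → odd t ≡ true
even-if-not-odd : ∀ t → odd t ≡ false → even t ≡ true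
odd-if-not-even (suc t) t∉even = even-if-not-odd t t∉even
even-if-not-odd zero    _      = refl
even-if-not-odd (suc t) t∉odd  = odd-if-not-even t t∉odd

even-double : ∀ k → even (k * 2) ≡ true
even-double zero    = refl
even-double (suc k) = even-double k

countParity : ∀ k → ∑ {k * 2} (λ i → ind (even (toℕ i))) ≡ k × ∑ {k * 2} (λ i → ind (odd (toℕ i))) ≡ k
countParity zero    = refl , refl
countParity (suc k) = cong suc (proj₁ (countParity k)) , cong suc (proj₂ (countParity k))

pathWithEdgesBound : ∀ m (B : Graph (suc m)) D → Symmetric B → Loopless B →
  IsPDominating 2 (path (suc m) ⊕ B) D → suc (suc m) ≤ ∣ D ∣ * 2 + edgeCount B
pathWithEdgesBound m B D sym-B loopless-B =
  twoDominationBound m (edgeCount B) (path (suc m) ⊕ B) D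
    (λ x y → cong₂ _∨_ (path-symmetric x y) (sym-B x y)) degSum≤
  where
  open ≤-Reasoning
  degSum≤ : degSum (path (suc m) ⊕ B) ≤ (m + edgeCount B) * 2
  degSum≤ = begin
    degSum (path (suc m) ⊕ B)                     ≤⟨ degSum-⊕ (path (suc m)) B ⟩
    degSum (path (suc m)) + degSum B              ≤⟨ +-mono-≤ (degSum-path m) (degSum≤2edgeCount B sym-B loopless-B) ⟩
    m * 2 + (edgeCount B + edgeCount B)           ≡⟨ cong (m * 2 +_) (double (edgeCount B)) ⟨
    m * 2 + edgeCount B * 2                       ≡⟨ *-distribʳ-+ 2 m (edgeCount B) ⟨
    (m + edgeCount B) * 2                         ∎

pathBound : ∀ m D → IsPDominating 2 (path (suc m)) D → suc (suc m) ≤ ∣ D ∣ * 2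
pathBound m D dom = subst (suc (suc m) ≤_) (+-identityʳ (∣ D ∣ * 2))
  (twoDominationBound m 0 (path (suc m)) D path-symmetric
    (subst (λ k → degSum (path (suc m)) ≤ k * 2) (sym (+-identityʳ m)) (degSum-path m)) dom)

-- On P_{2k+1} the k+1 even positions are 2-dominating, so γ₂(P_{2k+1}) ≤ k+1.
γ₂-oddPath≤ : ∀ k g → IsGammaP 2 (path (suc (k * 2))) g → g ≤ suc k
γ₂-oddPath≤ k g (_ , minimal) =
  minimal (suc k) (subsetOf even , twoDominating n pathRel even nbrs ,
                   trans (∣subsetOf∣ {n} even) (cong suc (proj₂ (countParity k))))
  where
  n = suc (k * 2)
  nbrs : ∀ x → x < n → even x ≡ false → TwoNeighbours pathRel even n x
  nbrs zero    _   ()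
  nbrs (suc t) x<n t+1∉D with suc (suc t) <? n
  ... | yes t+2<n = interiorNeighbours pathRel even n t (λ _ _ e → e) t+2<n
                      (even-if-not-odd t t+1∉D) (even-if-not-odd t t+1∉D)
  ... | no  t+2≮n
    with trans (sym t+1∉D) (trans (cong even (suc-injective (≤-antisym x<n (≮⇒≥ t+2≮n)))) (even-double k))
  ...   | ()

edge-disjoint : ∀ a b c d → a < b → c < d → ¬ a ≡ c →
  ∀ i j → edge a b i j ≡ true → edge c d i j ≡ false
edge-disjoint a b c d a<b c<d a≢c i j e with edge c d i j in e′
... | false = refl
... | true with edge-endpoints a b i j e | edge-endpoints c d i j e′
...   | inj₁ (refl , refl) | inj₁ (refl , _)    = ⊥-elim (a≢c refl)
...   | inj₁ (refl , refl) | inj₂ (refl , refl) = ⊥-elim (<-asym a<b c<d)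
...   | inj₂ (refl , refl) | inj₁ (refl , refl) = ⊥-elim (<-asym a<b c<d)
...   | inj₂ (refl , refl) | inj₂ (refl , _)    = ⊥-elim (a≢c refl)

-- On P_{2k+4}, the edge {0, n-1} closes a cycle on which the even positions are 2-dominating.
evenPositionsDominateCycle : ∀ k →
  IsPDominating 2 (path (suc (suc k) * 2) ⊕ induced (edge 0 (suc (suc (suc (k * 2)))))) (subsetOf even)
evenPositionsDominateCycle k = twoDominating n R even nbrs
  where
  n = suc (suc k) * 2
  last = suc (suc (suc (k * 2)))
  R : ℕ → ℕ → Bool
  R i j = pathRel i j ∨ edge 0 last i j
  nbrs : ∀ x → x < n → even x ≡ false → TwoNeighbours R even n x
  nbrs zero    _   ()
  nbrs (suc t) x<n t+1∉D with suc (suc t) <? n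
  ... | yes t+2<n = interiorNeighbours R even n t (λ i j → ∨-introˡ (edge 0 last i j)) t+2<n
                      (even-if-not-odd t t+1∉D) (even-if-not-odd t t+1∉D)
  ... | no  t+2≮n with ≤-antisym x<n (≮⇒≥ t+2≮n)
  ...   | refl = twoNeighbours t 0 (<-trans (n<1+n t) x<n) z<s (λ ()) (∨-introˡ _ (pathRel-left t))
                   (∨-introʳ _ (edge-ba 0 last)) (even-if-not-odd t t+1∉D) refl

-- The case p = 2, n = 2k + 4: γ₂ ≥ k + 3 by the degree count, while after joining
-- the two ends the k + 2 even positions are 2-dominating.  No edges at all cannot
-- help, so r₂ = 1.
evenPathReinforcement : ∀ k g → IsGammaP 2 (path (suc (suc k) * 2)) g → 2 < g →
  IsReinforcementP 2 (path (suc (suc k) * 2)) 1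
evenPathReinforcement k g γ≡g 2<g =
  reinforcementNumber 2 G g 1 γ≡g 2<g
    (B , edgeComplement 0 last (s≤s (s≤s z≤n)) , edgeCount-edge n 0 last z<s (n<1+n last) , reduces)
    (λ B′ (sym-B′ , loopless-B′ , _) count<1 →
       emptyNotReducing 2 G B′ g γ≡g sym-B′ loopless-B′ (n<1⇒n≡0 count<1))
  where
  n = suc (suc k) * 2
  last = suc (suc (suc (k * 2)))
  G = path n
  B : Graph n
  B = induced (edge 0 last)
  lower : ∀ D → IsPDominating 2 G D → suc (suc (suc k)) ≤ ∣ D ∣
  lower D dom = *-cancelʳ-< _ (suc (suc k)) ∣ D ∣ (pathBound last D dom)
  reduces : Reduces 2 G B
  reduces = reducesBelow 2 G B (suc (suc (suc k))) lower (subsetOf even) (evenPositionsDominateCycle k)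
              (≤-reflexive (cong suc (trans (∣subsetOf∣ {n} even) (proj₁ (countParity (suc (suc k)))))))

-- The edges {0, 3} and {n-4, n-1} on n = 2k + 5 vertices (so n - 4 = 2k + 1).
oddEdges : ℕ → ℕ → ℕ → Bool
oddEdges k i j = edge 0 3 i j ∨ edge (suc (k * 2)) (suc (suc (suc (suc (k * 2))))) i j

oddEdges-complement : ∀ k → IsComplementEdgeSet (path (suc (suc (suc k) * 2))) (induced (oddEdges k))
oddEdges-complement k = pathComplement (oddEdges k)
  (λ i j → cong₂ _∨_ (edge-symmetric 0 3 i j) (edge-symmetric A last i j))
  (λ i → cong₂ _∨_ (edge-loopless 0 3 (λ ()) i) (edge-loopless A last (<⇒≢ A<last) i))
  avoids
  where
  A = suc (k * 2)
  last = suc (suc (suc A))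
  A<last : A < last
  A<last = m≤n+m (suc A) 2
  avoids : ∀ i j → oddEdges k i j ≡ true → pathRel i j ≡ false
  avoids i j e with ∨-cases {edge 0 3 i j} e
  ... | inj₁ e₁ = edge-notPath 0 3 (s≤s (s≤s z≤n)) i j e₁
  ... | inj₂ e₂ = edge-notPath A last (n≤1+n (suc (suc A))) i j e₂

oddEdges-count : ∀ k → edgeCount (induced {suc (suc (suc k) * 2)} (oddEdges k)) ≡ 2
oddEdges-count k =
  trans (edgeCount-∪ (induced {n} (edge 0 3)) (induced (edge A last))
          (λ x y → edge-disjoint 0 3 A last z<s A<last (λ ()) (toℕ x) (toℕ y)))
        (cong₂ _+_ (edgeCount-edge n 0 3 z<s (s≤s (s≤s (s≤s (s≤s z≤n)))))
                   (edgeCount-edge n A last A<last (n<1+n last)))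
  where
  n = suc (suc (suc k) * 2)
  A = suc (k * 2)
  last = suc (suc (suc A))
  A<last : A < last
  A<last = m≤n+m (suc A) 2

-- With these two edges the odd positions of P_{2k+5} are 2-dominating: 0 is
-- dominated by 1 and 3, the last vertex by its left neighbour and n - 4.
oddPositionsDominate : ∀ k →
  IsPDominating 2 (path (suc (suc (suc k) * 2)) ⊕ induced (oddEdges k)) (subsetOf odd)
oddPositionsDominate k = twoDominating n R odd nbrs
  where
  n = suc (suc (suc k) * 2)
  A = suc (k * 2)
  last = suc (suc (suc A))
  R : ℕ → ℕ → Bool
  R i j = pathRel i j ∨ oddEdges k i j
  A<last : A < last
  A<last = m≤n+m (suc A) 2
  nbrs : ∀ x → x < n → odd x ≡ false → TwoNeighbours R odd n x
  nbrs zero    _   _ = twoNeighbours 1 3 (s≤s (s≤s z≤n)) (s≤s (s≤s (s≤s (s≤s z≤n)))) (λ ())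
                         refl refl refl refl
  nbrs (suc t) x<n t+1∉D with suc (suc t) <? n
  ... | yes t+2<n = interiorNeighbours R odd n t (λ i j → ∨-introˡ (oddEdges k i j)) t+2<n
                      (odd-if-not-even t t+1∉D) (odd-if-not-even t t+1∉D)
  ... | no  t+2≮n with ≤-antisym x<n (≮⇒≥ t+2≮n)
  ...   | refl = twoNeighbours t A (<-trans (n<1+n t) x<n) (<-trans A<last (n<1+n last))
                   (λ t≡A → <-irrefl (sym t≡A) (<-trans (n<1+n A) (n<1+n (suc A))))
                   (∨-introˡ _ (pathRel-left t))
                   (∨-introʳ (pathRel last A) (∨-introʳ (edge 0 3 last A) (edge-ba A last)))
                   (odd-if-not-even t t+1∉D) (even-double k)

-- The case p = 2, n = 2K + 1 with K = k + 2: γ₂ = K + 1 (even positions versus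
-- the degree count), and the degree count still gives |D| ≥ K + 1 after adding a
-- single edge, while oddEdges makes the K odd positions 2-dominating.
oddPathReinforcement : ∀ k g → IsGammaP 2 (path (suc (suc (suc k) * 2))) g → 2 < g →
  IsReinforcementP 2 (path (suc (suc (suc k) * 2))) 2
oddPathReinforcement k g γ≡g 2<g =
  reinforcementNumber 2 G g 2 γ≡g 2<g (B , oddEdges-complement k , oddEdges-count k , reduces) fewer
  where
  K = suc (suc k)
  n = suc (K * 2)
  G = path n
  B : Graph n
  B = induced (oddEdges k)
  lower : ∀ D → IsPDominating 2 G D → suc K ≤ ∣ D ∣
  lower D dom = *-cancelʳ-≤ (suc K) ∣ D ∣ 2 (pathBound (K * 2) D dom)
  reduces : Reduces 2 G B
  reduces = reducesBelow 2 G B (suc K) lower (subsetOf odd) (oddPositionsDominate k)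
              (≤-reflexive (cong suc (trans (∣subsetOf∣ {n} odd) (proj₁ (countParity K)))))
  fewer : ∀ B′ → IsComplementEdgeSet G B′ → edgeCount B′ < 2 → ¬ Reduces 2 G B′
  fewer B′ (sym-B′ , loopless-B′ , _) count<2 = notReducing 2 G B′ g γ≡g bound
    where
    bound : ∀ D → IsPDominating 2 (G ⊕ B′) D → g ≤ ∣ D ∣
    bound D dom = ≤-trans (γ₂-oddPath≤ K g γ≡g) (*-cancelʳ-< 2 K ∣ D ∣ (≤-pred (begin
      suc K * 2                     ≤⟨ pathWithEdgesBound (K * 2) B′ D sym-B′ loopless-B′ dom ⟩
      ∣ D ∣ * 2 + edgeCount B′      ≤⟨ +-monoʳ-≤ (∣ D ∣ * 2) (≤-pred count<2) ⟩
      ∣ D ∣ * 2 + 1                 ≡⟨ +-comm (∣ D ∣ * 2) 1 ⟩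
      suc (∣ D ∣ * 2)               ∎)))
      where open ≤-Reasoning

-- The star joining vertex 1 to the leaves 3, …, q + 2.

starLeaf : ℕ → ℕ → Bool
starLeaf q (suc (suc (suc t))) = t <ᵇ q
starLeaf q _                   = false

star : ℕ → ℕ → ℕ → Bool
star q i j = ((i ≡ᵇ 1) ∧ starLeaf q j) ∨ ((j ≡ᵇ 1) ∧ starLeaf q i)

star-loopless : ∀ q i → star q i i ≡ false
star-loopless q zero          = refl
star-loopless q (suc zero)    = refl
star-loopless q (suc (suc i)) = refl

leaf-far : ∀ q j → starLeaf q j ≡ true → suc 1 < j
leaf-far q (suc (suc (suc t))) _ = s≤s (s≤s (s≤s z≤n))

-- The leaves are at distance at least 2 from the centre 1.
star-notPath : ∀ q i j → star q i j ≡ true → pathRel i j ≡ false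
star-notPath q i j e with ∨-cases {(i ≡ᵇ 1) ∧ starLeaf q j} e
... | inj₁ e₁ with ∧-true {i ≡ᵇ 1} e₁
...   | i≟1 , j-leaf rewrite ≡ᵇ-true i 1 i≟1 = pathRel-far 1 j (leaf-far q j j-leaf)
star-notPath q i j e | inj₂ e₂ with ∧-true {j ≡ᵇ 1} e₂
...   | j≟1 , i-leaf rewrite ≡ᵇ-true j 1 j≟1 = trans (pathRel-sym i 1) (pathRel-far 1 i (leaf-far q i i-leaf))

star-upper : ∀ q i j → (star q i j ∧ (i <ᵇ j)) ≡ ((i ≡ᵇ 1) ∧ starLeaf q j)
star-upper q zero          zero                = refl
star-upper q zero          (suc zero)          = refl
star-upper q zero          (suc (suc j))       = refl
star-upper q (suc zero)    zero                = refl
star-upper q (suc zero)    (suc zero)          = refl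
star-upper q (suc zero)    (suc (suc zero))    = refl
star-upper q (suc zero)    (suc (suc (suc t))) rewrite ∨-identityʳ (t <ᵇ q) = ∧-identityʳ (t <ᵇ q)
star-upper q (suc (suc i)) zero                = refl
star-upper q (suc (suc i)) (suc zero)          = ∧-zeroʳ (starLeaf q (suc (suc i)))
star-upper q (suc (suc i)) (suc (suc j))       = refl

edgeCount-star : ∀ m q → q ≤ suc m → edgeCount (induced {suc (suc (suc (suc m)))} (star q)) ≡ q
edgeCount-star m q q≤m+1 = begin
  edgeCount (induced {n} (star q))                                ≡⟨ edgeCount≡∑ (induced {n} (star q)) ⟩
  ∑ {n} (λ i → ∑ {n} (λ j → ind (star q (toℕ i) (toℕ j) ∧ (toℕ i <ᵇ toℕ j))))
                                                                  ≡⟨ sum-cong-≗ {n} (λ i → sum-cong-≗ {n} (λ j →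
                                                                       cong ind (star-upper q (toℕ i) (toℕ j)))) ⟩
  ∑ {n} (λ _ → 0) + (∑ {suc m} (λ t → ind (toℕ t <ᵇ q)) + ∑ {suc (suc m)} (λ _ → ∑ {n} (λ _ → 0)))
                                                                  ≡⟨ cong₂ _+_ (sum-replicate-zero n)
                                                                       (cong₂ _+_ (countBelow (suc m) q) noOtherRows) ⟩
  suc m ⊓ q + 0                                                   ≡⟨ +-identityʳ (suc m ⊓ q) ⟩
  suc m ⊓ q                                                       ≡⟨ m≥n⇒m⊓n≡n q≤m+1 ⟩
  q                                                               ∎
  where
  open ≡-Reasoning
  n = suc (suc (suc (suc m)))
  noOtherRows : ∑ {suc (suc m)} (λ _ → ∑ {n} (λ _ → 0)) ≡ 0
  noOtherRows = trans (sum-cong-≗ {suc (suc m)} (λ _ → sum-replicate-zero n)) (sum-replicate-zero (suc (suc m)))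

starCentreNeighbours : ∀ m q → q ≤ suc m →
  nbrsIn (path (suc (suc (suc (suc m)))) ⊕ induced (star q)) (subsetOf (λ i → not (i ≡ᵇ 1))) (suc zero)
    ≡ suc (suc q)
starCentreNeighbours m q q≤m+1 = begin
  nbrsIn H D (suc zero)                                         ≡⟨ nbrsIn≡∑ H D (suc zero) ⟩
  ∑ (λ y → ind (H (suc zero) y ∧ lookup D y))                   ≡⟨ sum-cong-≗ {n} (λ y →
                                                                     cong (λ b → ind (H (suc zero) y ∧ b)) (lookup-subsetOf (λ i → not (i ≡ᵇ 1)) y)) ⟩
  suc (suc (∑ {suc m} (λ t → ind (((toℕ t <ᵇ q) ∨ false) ∧ true))))
                                                                ≡⟨ cong (λ k → suc (suc k)) (sum-cong-≗ {suc m} (λ t →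
                                                                     cong ind (trans (∧-identityʳ ((toℕ t <ᵇ q) ∨ false)) (∨-identityʳ (toℕ t <ᵇ q))))) ⟩
  suc (suc (∑ {suc m} (λ t → ind (toℕ t <ᵇ q))))               ≡⟨ cong (λ k → suc (suc k)) (countBelow (suc m) q) ⟩
  suc (suc (suc m ⊓ q))                                         ≡⟨ cong (λ k → suc (suc k)) (m≥n⇒m⊓n≡n q≤m+1) ⟩
  suc (suc q)                                                   ∎
  where
  open ≡-Reasoning
  n = suc (suc (suc (suc m)))
  H : Graph n
  H = path n ⊕ induced (star q)
  D : Subset n
  D = subsetOf (λ i → not (i ≡ᵇ 1))

allButCentreDominates : ∀ m q → q ≤ suc m →
  IsPDominating (suc (suc q)) (path (suc (suc (suc (suc m)))) ⊕ induced (star q))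
    (subsetOf (λ i → not (i ≡ᵇ 1)))
allButCentreDominates m q q≤m+1 zero ()
allButCentreDominates m q q≤m+1 (suc zero) _ = ≤-reflexive (sym (starCentreNeighbours m q q≤m+1))
allButCentreDominates m q q≤m+1 (suc (suc y)) y∉D
  with trans (sym (lookup-subsetOf (λ i → not (i ≡ᵇ 1)) (suc (suc y)))) y∉D
... | ()

-- The case p = q + 2 ≥ 3 on n = m + 4 ≥ p + 1 vertices: as all degrees of P_n are
-- at most 2 < p, γ_p(P_n) = n, and fewer than q extra edges keep every degree
-- below p.  Adding the star makes V ∖ {1} p-dominating, so r_p = q = p - 2.
starReinforcement : ∀ q m → 1 ≤ q → q ≤ suc m → ∀ g →
  IsGammaP (suc (suc q)) (path (suc (suc (suc (suc m))))) g → suc (suc q) < g →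
  IsReinforcementP (suc (suc q)) (path (suc (suc (suc (suc m))))) q
starReinforcement q m 1≤q q≤m+1 g γ≡g p<g =
  reinforcementNumber p G g q γ≡g p<g (B , complement , edgeCount-star m q q≤m+1 , reduces) fewer
  where
  p = suc (suc q)
  n = suc (suc (suc (suc m)))
  G = path n
  B : Graph n
  B = induced (star q)
  complement : IsComplementEdgeSet G B
  complement = pathComplement (star q)
    (λ i j → ∨-comm ((i ≡ᵇ 1) ∧ starLeaf q j) ((j ≡ᵇ 1) ∧ starLeaf q i)) (star-loopless q) (star-notPath q)
  allButCentre : Subset n
  allButCentre = subsetOf (λ i → not (i ≡ᵇ 1))
  lower : ∀ D → IsPDominating p G D → n ≤ ∣ D ∣
  lower D dom = ≤-reflexive (sym (lowDegreeFull p G D (λ x → s≤s (≤-trans (deg-path≤2 x) (s≤s 1≤q))) dom))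
  reduces : Reduces p G B
  reduces = reducesBelow p G B n lower allButCentre (allButCentreDominates m q q≤m+1)
              (≤-reflexive (cong suc (trans (∣subsetOf∣ {n} (λ i → not (i ≡ᵇ 1))) (cong suc (∑-ones (suc (suc m)))))))
  fewer : ∀ B′ → IsComplementEdgeSet G B′ → edgeCount B′ < q → ¬ Reduces p G B′
  fewer B′ (sym-B′ , loopless-B′ , _) count<q = notReducing p G B′ g γ≡g bound
    where
    lowDeg : ∀ x → deg (G ⊕ B′) x < p
    lowDeg x = begin-strict
      deg (G ⊕ B′) x          ≤⟨ deg-⊕ G B′ x ⟩
      deg G x + deg B′ x      ≤⟨ +-mono-≤ (deg-path≤2 x) (deg≤edgeCount B′ sym-B′ loopless-B′ x) ⟩
      2 + edgeCount B′        <⟨ +-monoʳ-< 2 count<q ⟩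
      p                       ∎
      where open ≤-Reasoning
    bound : ∀ D → IsPDominating p (G ⊕ B′) D → g ≤ ∣ D ∣
    bound D dom = subst (g ≤_) (sym (lowDegreeFull p (G ⊕ B′) D lowDeg dom)) (γ≤n p G g γ≡g)

-- For p ≥ 3, p < γ_p(P_n) ≤ n brings P_n into the shape of starReinforcement.
longPathReinforcement : ∀ p n g → 3 ≤ p → IsGammaP p (path n) g → p < g →
  IsReinforcementP p (path n) (p ∸ 2)
longPathReinforcement (suc (suc (suc p′))) n g (s≤s (s≤s (s≤s z≤n))) γ≡g p<g with <-≤-trans p<g (γ≤n _ (path n) g γ≡g)
... | s≤s (s≤s (s≤s (s≤s p′≤m))) = starReinforcement (suc p′) _ (s≤s z≤n) (s≤s p′≤m) g γ≡g p<g

odd-shape : ∀ n → n % 2 ≡ 1 → n ≡ suc (n / 2 * 2)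
odd-shape n n-odd = trans (m≡m%n+[m/n]*n n 2) (cong (_+ n / 2 * 2) n-odd)

even-shape : ∀ n → n % 2 ≡ 0 → n ≡ n / 2 * 2
even-shape n n-even = trans (m≡m%n+[m/n]*n n 2) (cong (_+ n / 2 * 2) n-even)

-- For odd n, γ₂(P_n) > 2 excludes n ≤ 3, leaving oddPathReinforcement.
oddPath : ∀ n g → IsGammaP 2 (path n) g → 2 < g → n % 2 ≡ 1 → IsReinforcementP 2 (path n) 2
oddPath n g γ≡g 2<g n-odd with n / 2 | odd-shape n n-odd
... | suc (suc k) | refl = oddPathReinforcement k g γ≡g 2<g
... | 0           | refl = ⊥-elim (<⇒≱ 2<g (≤-trans (γ≤n 2 (path 1) g γ≡g) (s≤s z≤n)))
... | 1           | refl = ⊥-elim (<⇒≱ 2<g (γ₂-oddPath≤ 1 g γ≡g))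

-- For even n, γ₂(P_n) > 2 excludes n ≤ 2, leaving evenPathReinforcement.
evenPath : ∀ n g → IsGammaP 2 (path n) g → 2 < g → n % 2 ≡ 0 → IsReinforcementP 2 (path n) 1
evenPath n g γ≡g 2<g n-even with n / 2 | even-shape n n-even
... | suc (suc k) | refl = evenPathReinforcement k g γ≡g 2<g
... | 0           | refl = ⊥-elim (<⇒≱ 2<g (≤-trans (γ≤n 2 (path 0) g γ≡g) z≤n))
... | 1           | refl = ⊥-elim (<⇒≱ 2<g (γ≤n 2 (path 2) g γ≡g))

theorem3p2 : (p n g : ℕ) → 2 ≤ p → IsGammaP p (path n) g → p < g →
    (p ≡ 2 → n % 2 ≡ 1 → IsReinforcementP p (path n) 2) ×
    (p ≡ 2 → n % 2 ≡ 0 → IsReinforcementP p (path n) 1) ×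
    (3 ≤ p → IsReinforcementP p (path n) (p ∸ 2))
theorem3p2 p n g _ γ≡g p<g =
  (λ { refl n-odd  → oddPath n g γ≡g p<g n-odd }) ,
  (λ { refl n-even → evenPath n g γ≡g p<g n-even }) ,
  (λ 3≤p → longPathReinforcement p n g 3≤p γ≡g p<g)
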